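{- Let $\mathcal{D}$ be the set of all Dyck paths, and for $D\in\mathcal{D}$ let $|D|$ be its semilength and $\mathrm{sval}(D)$ its number of symmetric valleys. Then $$\sum_{D\in\mathcal{D}}\mathrm{sval}(D)z^{|D|}=\frac{2z^2}{1-3z-4z^2+(1-z)\sqrt{1-4z}}.$$
   Context: A Dyck path of semilength $n$ is a lattice path with steps $\mathbf{u}=(1,1)$ and $\mathbf{d}=(1,-1)$ from $(0,0)$ to $(2n,0)$ never going below the $x$-axis. A valley is an occurrence of consecutive steps $\mathbf{du}$. Every valley is contained in a unique maximal consecutive subsequence of the form $\mathbf{d}^i\mathbf{u}^j$ ($i,j\ge1$); the valley is symmetric if $i=j$. -}

module Defs where

open import Data.Nat using (ℕ; zero; suc; _+_; _*_; _∸_; _≡ᵇ_)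
open import Data.Bool using (Bool; true; false; if_then_else_; _∧_)
open import Data.List using (List; []; _∷_; map; concatMap; filter; length; upTo; foldr)
open import Data.Nat.ListAction using (sum)
open import Data.Product using (_×_; _,_)
open import Data.Integer as ℤ using (ℤ)

-- Steps of a lattice path: u = (1,1), d = (1,-1)
data Step : Set where
  u d : Step

-- A word is a Dyck path iff it never goes below the x-axis and ends at height 0.
-- dyckFrom h w : starting at height h, the word w stays ≥ 0 and ends at height 0.
dyckFrom : ℕ → List Step → Bool
dyckFrom zero    []      = true
dyckFrom (suc h) []      = false
dyckFrom h       (u ∷ w) = dyckFrom (suc h) w
dyckFrom zero    (d ∷ w) = false
dyckFrom (suc h) (d ∷ w) = dyckFrom h w

isDyck : List Step → Bool
isDyck = dyckFrom zero

words : ℕ → List (List Step)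
words zero    = [] ∷ []
words (suc m) = concatMap (λ w → (u ∷ w) ∷ (d ∷ w) ∷ []) (words m)

dyckPaths : ℕ → List (List Step)
dyckPaths n = filter (λ w → Data.Bool.T? (isDyck w)) (words (2 * n))
  where import Data.Bool

sameStep : Step → Step → Bool
sameStep u u = true
sameStep d d = true
sameStep _ _ = false

runs : List Step → List (Step × ℕ)
runs [] = []
runs (s ∷ w) with runs w
... | [] = (s , 1) ∷ []
... | (t , k) ∷ rs = if sameStep s t then (t , suc k) ∷ rs else (s , 1) ∷ (t , k) ∷ rs

-- a valley du lies in the maximal factor d^i u^j formed by a maximal d-run
-- immediately followed by a maximal u-run; it is symmetric iff i = j.
svalRuns : List (Step × ℕ) → ℕ
svalRuns ((d , i) ∷ (u , j) ∷ rs) = (if i ≡ᵇ j then 1 else 0) + svalRuns ((u , j) ∷ rs)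
svalRuns (_ ∷ rs) = svalRuns rs
svalRuns [] = 0

sval : List Step → ℕ
sval w = svalRuns (runs w)

PS : Set
PS = ℕ → ℤ

_⊛_ : PS → PS → PS
(f ⊛ g) n = foldr ℤ._+_ (ℤ.+ 0) (map (λ k → f k ℤ.* g (n ∸ k)) (upTo (suc n)))

_⊕_ : PS → PS → PS
(f ⊕ g) n = f n ℤ.+ g n

poly : List ℤ → PS
poly []       n       = ℤ.+ 0
poly (c ∷ cs) zero    = c
poly (c ∷ cs) (suc n) = poly cs n

svalGF : PS
svalGF n = ℤ.+ (sum (map sval (dyckPaths n)))

oneMinus4z : PS
oneMinus4z = poly (ℤ.+ 1 ∷ ℤ.- ℤ.+ 4 ∷ [])

-- denominator 1 - 3z - 4z² + (1 - z)·S, where S = √(1-4z)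
denom : PS → PS
denom S = poly (ℤ.+ 1 ∷ ℤ.- ℤ.+ 3 ∷ ℤ.- ℤ.+ 4 ∷ []) ⊕ (poly (ℤ.+ 1 ∷ ℤ.- ℤ.+ 1 ∷ []) ⊛ S)

numer : PS
numer = poly (ℤ.+ 0 ∷ ℤ.+ 0 ∷ ℤ.+ 2 ∷ [])

-- Decompose a nonempty Dyck path at its first return, D = u A d B. Its symmetric valleys are
-- those of A and of B, plus possibly one at the junction d B, which is symmetric iff the
-- trailing d-run of A is one step shorter than the leading u-run of B. Let C, F, G, H be the
-- generating functions of Dyck paths, of sval, of such symmetric junctions over pairs (A, B),
-- and of pairs (A, B) whose trailing d-run and leading u-run have equal length. Decomposing
-- A and B once more gives
--   C = 1 + zC²,  F = z(2FC + G),  G = zHC,  H = 1 + z(G + C(H − 1)).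
-- Since √(1 − 4z) = 1 − 2zC, eliminating G and H yields F · (1 − 3z − 4z² + (1 − z)√(1 − 4z)) = 2z².

module Submission where

open import Defs

module PowerSeries where

  open import Data.Nat as ℕ using (zero; suc; _∸_; _≤_; z≤n)
  import Data.Nat.Properties as ℕ
  open import Data.Integer as ℤ using (ℤ; +_; _+_; _*_; -_; 0ℤ)
  import Data.Integer.Properties as ℤ
  open import Data.Integer.Tactic.RingSolver using (solve-∀)
  open import Data.List using ([]; _∷_; foldr; applyUpTo)
  open import Data.List.Properties using (map-upTo)
  open import Data.Maybe using (Maybe; just; nothing)
  open import Data.Product using (_,_)
  open import Data.Sum using (inj₁; inj₂)
  open import Relation.Nullary using (yes; no)
  open import Data.Empty using (⊥-elim)
  open import Relation.Binary.PropositionalEquality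
  open import Function using (_∘_)
  open import Algebra.Bundles using (CommutativeRing)
  open import Algebra.Structures using (IsCommutativeRing)
  import Algebra.Solver.Ring.AlmostCommutativeRing as ACR

  𝟘 𝟙 z : PS
  𝟘 _ = 0ℤ
  𝟙 = poly (+ 1 ∷ [])
  z = poly (0ℤ ∷ + 1 ∷ [])

  constPS : ℤ → PS
  constPS c = poly (c ∷ [])

  ⊖_ : PS → PS
  (⊖ f) n = - f n

  _⊝_ : PS → PS → PS
  f ⊝ g = f ⊕ (⊖ g)

  conv : PS → PS → PS
  conv f g zero    = f 0 * g 0
  conv f g (suc n) = f 0 * g (suc n) + conv (f ∘ suc) g n

  foldr-applyUpTo≡conv : ∀ f g n →
    foldr _+_ 0ℤ (applyUpTo (λ k → f k * g (n ∸ k)) (suc n)) ≡ conv f g n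
  foldr-applyUpTo≡conv f g zero    = ℤ.+-identityʳ _
  foldr-applyUpTo≡conv f g (suc n) = cong (_+_ (f 0 * g (suc n))) (foldr-applyUpTo≡conv (f ∘ suc) g n)

  ⊛≗conv : ∀ f g → f ⊛ g ≗ conv f g
  ⊛≗conv f g n = trans (cong (foldr _+_ 0ℤ) (map-upTo (λ k → f k * g (n ∸ k)) (suc n))) (foldr-applyUpTo≡conv f g n)

  conv-cong : ∀ {f f′ g g′} → f ≗ f′ → g ≗ g′ → conv f g ≗ conv f′ g′
  conv-cong p q zero    = cong₂ _*_ (p 0) (q 0)
  conv-cong p q (suc n) = cong₂ _+_ (cong₂ _*_ (p 0) (q (suc n))) (conv-cong (p ∘ suc) q n)

  conv-distribʳ : ∀ f g h → conv (f ⊕ g) h ≗ conv f h ⊕ conv g h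
  conv-distribʳ f g h zero    = ℤ.*-distribʳ-+ (h 0) (f 0) (g 0)
  conv-distribʳ f g h (suc n) rewrite conv-distribʳ (f ∘ suc) (g ∘ suc) h n =
    shuffle (f 0) (g 0) (h (suc n)) (conv (f ∘ suc) h n) (conv (g ∘ suc) h n)
    where
    shuffle : ∀ a b c x y → (a + b) * c + (x + y) ≡ (a * c + x) + (b * c + y)
    shuffle = solve-∀

  conv-distribˡ : ∀ f g h → conv f (g ⊕ h) ≗ conv f g ⊕ conv f h
  conv-distribˡ f g h zero    = ℤ.*-distribˡ-+ (f 0) (g 0) (h 0)
  conv-distribˡ f g h (suc n) rewrite conv-distribˡ (f ∘ suc) g h n =
    shuffle (f 0) (g (suc n)) (h (suc n)) (conv (f ∘ suc) g n) (conv (f ∘ suc) h n)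
    where
    shuffle : ∀ a b c x y → a * (b + c) + (x + y) ≡ (a * b + x) + (a * c + y)
    shuffle = solve-∀

  conv-scaleˡ : ∀ c f g → conv (λ k → c * f k) g ≗ (λ n → c * conv f g n)
  conv-scaleˡ c f g zero    = ℤ.*-assoc c (f 0) (g 0)
  conv-scaleˡ c f g (suc n) rewrite conv-scaleˡ c (f ∘ suc) g n =
    factor c (f 0) (g (suc n)) (conv (f ∘ suc) g n)
    where
    factor : ∀ c a b x → c * a * b + c * x ≡ c * (a * b + x)
    factor = solve-∀

  conv-zeroˡ : ∀ f g → f ≗ 𝟘 → conv f g ≗ 𝟘
  conv-zeroˡ f g p zero    rewrite p 0 = refl
  conv-zeroˡ f g p (suc n) rewrite p 0 | conv-zeroˡ (f ∘ suc) g (p ∘ suc) n = refl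

  conv-vanishʳ : ∀ f g n → (∀ k → k ≤ n → g k ≡ 0ℤ) → conv f g n ≡ 0ℤ
  conv-vanishʳ f g zero    p rewrite p 0 z≤n = ℤ.*-zeroʳ (f 0)
  conv-vanishʳ f g (suc n) p rewrite p (suc n) ℕ.≤-refl | ℤ.*-zeroʳ (f 0) =
    trans (ℤ.+-identityˡ _) (conv-vanishʳ (f ∘ suc) g n (λ k k≤n → p k (ℕ.m≤n⇒m≤1+n k≤n)))

  conv-identityˡ : ∀ g → conv 𝟙 g ≗ g
  conv-identityˡ g zero    = ℤ.*-identityˡ (g 0)
  conv-identityˡ g (suc n) rewrite conv-zeroˡ (𝟙 ∘ suc) g (λ _ → refl) n =
    trans (ℤ.+-identityʳ _) (ℤ.*-identityˡ _)

  conv-identityʳ : ∀ f → conv f 𝟙 ≗ f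
  conv-identityʳ f zero    = ℤ.*-identityʳ (f 0)
  conv-identityʳ f (suc n) rewrite conv-identityʳ (f ∘ suc) n | ℤ.*-zeroʳ (f 0) = ℤ.+-identityˡ _

  conv-suc : ∀ f g n → conv f g (suc n) ≡ conv f (g ∘ suc) n + f (suc n) * g 0
  conv-suc f g zero    = refl
  conv-suc f g (suc n) rewrite conv-suc (f ∘ suc) g n =
    sym (ℤ.+-assoc (f 0 * g (suc (suc n))) (conv (f ∘ suc) (g ∘ suc) n) (f (suc (suc n)) * g 0))

  conv-comm : ∀ f g → conv f g ≗ conv g f
  conv-comm f g zero    = ℤ.*-comm (f 0) (g 0)
  conv-comm f g (suc n) rewrite conv-comm (f ∘ suc) g n | conv-suc g f n =
    trans (ℤ.+-comm (f 0 * g (suc n)) (conv g (f ∘ suc) n))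
          (cong (_+_ (conv g (f ∘ suc) n)) (ℤ.*-comm (f 0) (g (suc n))))

  conv-assoc : ∀ f g h → conv (conv f g) h ≗ conv f (conv g h)
  conv-assoc f g h zero    = ℤ.*-assoc (f 0) (g 0) (h 0)
  conv-assoc f g h (suc n) = begin
      f 0 * g 0 * h (suc n) + conv (conv f g ∘ suc) h n
    ≡⟨ cong (_+_ (f 0 * g 0 * h (suc n))) tail ⟩
      f 0 * g 0 * h (suc n) + (f 0 * conv (g ∘ suc) h n + conv (f ∘ suc) (conv g h) n)
    ≡⟨ regroup (f 0) (g 0) (h (suc n)) (conv (g ∘ suc) h n) (conv (f ∘ suc) (conv g h) n) ⟩
      f 0 * conv g h (suc n) + conv (f ∘ suc) (conv g h) n
    ∎
    where
    open ≡-Reasoning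
    regroup : ∀ a b c x y → a * b * c + (a * x + y) ≡ a * (b * c + x) + y
    regroup = solve-∀
    tail : conv (conv f g ∘ suc) h n ≡ f 0 * conv (g ∘ suc) h n + conv (f ∘ suc) (conv g h) n
    tail = begin
        conv ((λ m → f 0 * g (suc m)) ⊕ conv (f ∘ suc) g) h n
      ≡⟨ conv-distribʳ (λ m → f 0 * g (suc m)) (conv (f ∘ suc) g) h n ⟩
        conv (λ m → f 0 * g (suc m)) h n + conv (conv (f ∘ suc) g) h n
      ≡⟨ cong₂ _+_ (conv-scaleˡ (f 0) (g ∘ suc) h n) (conv-assoc (f ∘ suc) g h n) ⟩
        f 0 * conv (g ∘ suc) h n + conv (f ∘ suc) (conv g h) n
      ∎

  ⊛-cong : ∀ {f f′ g g′} → f ≗ f′ → g ≗ g′ → f ⊛ g ≗ f′ ⊛ g′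
  ⊛-cong {f} {f′} {g} {g′} p q n =
    trans (⊛≗conv f g n) (trans (conv-cong p q n) (sym (⊛≗conv f′ g′ n)))

  ⊛-assoc : ∀ f g h → (f ⊛ g) ⊛ h ≗ f ⊛ (g ⊛ h)
  ⊛-assoc f g h n = begin
    ((f ⊛ g) ⊛ h) n      ≡⟨ ⊛≗conv (f ⊛ g) h n ⟩
    conv (f ⊛ g) h n     ≡⟨ conv-cong (⊛≗conv f g) (λ _ → refl) n ⟩
    conv (conv f g) h n  ≡⟨ conv-assoc f g h n ⟩
    conv f (conv g h) n  ≡⟨ conv-cong (λ _ → refl) (λ m → sym (⊛≗conv g h m)) n ⟩
    conv f (g ⊛ h) n     ≡⟨ ⊛≗conv f (g ⊛ h) n ⟨
    (f ⊛ (g ⊛ h)) n      ∎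
    where open ≡-Reasoning

  ⊛-comm : ∀ f g → f ⊛ g ≗ g ⊛ f
  ⊛-comm f g n = trans (⊛≗conv f g n) (trans (conv-comm f g n) (sym (⊛≗conv g f n)))

  ⊛-identityˡ : ∀ g → 𝟙 ⊛ g ≗ g
  ⊛-identityˡ g n = trans (⊛≗conv 𝟙 g n) (conv-identityˡ g n)

  ⊛-identityʳ : ∀ f → f ⊛ 𝟙 ≗ f
  ⊛-identityʳ f n = trans (⊛≗conv f 𝟙 n) (conv-identityʳ f n)

  ⊛-distribˡ : ∀ f g h → f ⊛ (g ⊕ h) ≗ (f ⊛ g) ⊕ (f ⊛ h)
  ⊛-distribˡ f g h n = trans (⊛≗conv f (g ⊕ h) n)
    (trans (conv-distribˡ f g h n) (sym (cong₂ _+_ (⊛≗conv f g n) (⊛≗conv f h n))))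

  ⊛-distribʳ : ∀ f g h → (g ⊕ h) ⊛ f ≗ (g ⊛ f) ⊕ (h ⊛ f)
  ⊛-distribʳ f g h n = trans (⊛≗conv (g ⊕ h) f n)
    (trans (conv-distribʳ g h f n) (sym (cong₂ _+_ (⊛≗conv g f n) (⊛≗conv h f n))))

  ⊛-zeroʳ : ∀ f → f ⊛ 𝟘 ≗ 𝟘
  ⊛-zeroʳ f n = trans (⊛≗conv f 𝟘 n) (conv-vanishʳ f 𝟘 n (λ _ _ → refl))

  isCommutativeRing : IsCommutativeRing _≗_ _⊕_ _⊛_ ⊖_ 𝟘 𝟙
  isCommutativeRing = record
    { isRing = record
      { +-isAbelianGroup = record
        { isGroup = record
          { isMonoid = record
            { isSemigroup = record
              { isMagma = record
                { isEquivalence = record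
                  { refl = λ _ → refl ; sym = λ p n → sym (p n) ; trans = λ p q n → trans (p n) (q n) }
                ; ∙-cong = λ p q n → cong₂ _+_ (p n) (q n) }
              ; assoc = λ f g h n → ℤ.+-assoc (f n) (g n) (h n) }
            ; identity = (λ f n → ℤ.+-identityˡ (f n)) , (λ f n → ℤ.+-identityʳ (f n)) }
          ; inverse = (λ f n → ℤ.+-inverseˡ (f n)) , (λ f n → ℤ.+-inverseʳ (f n))
          ; ⁻¹-cong = λ p n → cong -_ (p n) }
        ; comm = λ f g n → ℤ.+-comm (f n) (g n) }
      ; *-cong = ⊛-cong
      ; *-assoc = ⊛-assoc
      ; *-identity = ⊛-identityˡ , ⊛-identityʳ
      ; distrib = ⊛-distribˡ , ⊛-distribʳ }
    ; *-comm = ⊛-comm }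

  commutativeRing : CommutativeRing _ _
  commutativeRing = record { isCommutativeRing = isCommutativeRing }

  constPS-⊛ : ∀ c f → constPS c ⊛ f ≗ (λ n → c * f n)
  constPS-⊛ c f n = trans (⊛≗conv (constPS c) f n) (conv-const n)
    where
    conv-const : ∀ n → conv (constPS c) f n ≡ c * f n
    conv-const zero    = refl
    conv-const (suc n) = trans (cong (_+_ (c * f (suc n))) (conv-zeroˡ (constPS c ∘ suc) f (λ _ → refl) n))
                               (ℤ.+-identityʳ _)

  constPS-homomorphism : CommutativeRing.rawRing ℤ.+-*-commutativeRing
                           ACR.-Raw-AlmostCommutative⟶ ACR.fromCommutativeRing commutativeRing
  constPS-homomorphism = record
    { ⟦_⟧    = constPS
    ; +-homo = λ { a b zero → refl ; a b (suc n) → refl }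
    ; *-homo = λ a b n → sym (trans (constPS-⊛ a (constPS b) n) (const-* a b n))
    ; -‿homo = λ { a zero → refl ; a (suc n) → refl }
    ; 0-homo = λ { zero → refl ; (suc n) → refl }
    ; 1-homo = λ { zero → refl ; (suc n) → refl } }
    where
    const-* : ∀ a b n → a * constPS b n ≡ constPS (a * b) n
    const-* a b zero    = refl
    const-* a b (suc n) = ℤ.*-zeroʳ a

  constPS-≟ : ∀ a b → Maybe (constPS a ≗ constPS b)
  constPS-≟ a b with a ℤ.≟ b
  ... | yes refl = just (λ _ → refl)
  ... | no _     = nothing

  open import Algebra.Solver.Ring _ _ constPS-homomorphism constPS-≟ public
    using (solve; _:=_; _:+_; _:*_; _:-_; con)

  z⊛-zero : ∀ f → (z ⊛ f) 0 ≡ 0ℤ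
  z⊛-zero f = ⊛≗conv z f 0

  z⊛-suc : ∀ f n → (z ⊛ f) (suc n) ≡ f n
  z⊛-suc f n = trans (⊛≗conv z f (suc n)) (trans (ℤ.+-identityˡ _) (conv-identityˡ f n))

  ⊛-cancelʳ : ∀ f g → g 0 ≢ 0ℤ → f ⊛ g ≗ 𝟘 → f ≗ 𝟘
  ⊛-cancelʳ f g g₀≢0 fg≗0 n = vanish n n ℕ.≤-refl
    where
    gf-vanish : ∀ n → conv g f n ≡ 0ℤ
    gf-vanish n = trans (sym (⊛≗conv g f n)) (trans (⊛-comm g f n) (fg≗0 n))
    cancel : ∀ {k} → g 0 * f k ≡ 0ℤ → f k ≡ 0ℤ
    cancel {k} eq with ℤ.i*j≡0⇒i≡0∨j≡0 (g 0) eq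
    ... | inj₁ g₀≡0 = ⊥-elim (g₀≢0 g₀≡0)
    ... | inj₂ fₖ≡0 = fₖ≡0
    vanish : ∀ n k → k ≤ n → f k ≡ 0ℤ
    vanish zero    .zero z≤n = cancel (gf-vanish 0)
    vanish (suc n) k k≤1+n with ℕ.m≤n⇒m<n∨m≡n k≤1+n
    ... | inj₁ k<1+n = vanish n k (ℕ.s≤s⁻¹ k<1+n)
    ... | inj₂ refl  = cancel (begin
      g 0 * f (suc n)                               ≡⟨ ℤ.+-identityʳ _ ⟨
      g 0 * f (suc n) + 0ℤ                          ≡⟨ cong (_+_ (g 0 * f (suc n))) (conv-vanishʳ (g ∘ suc) f n (vanish n)) ⟨
      g 0 * f (suc n) + conv (g ∘ suc) f n          ≡⟨ gf-vanish (suc n) ⟩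
      0ℤ                                            ∎)
      where open ≡-Reasoning

module AntidiagonalSums where

  open import Data.Nat
  open import Data.Nat.Properties
  open import Relation.Binary.PropositionalEquality
  open import Data.Nat.Tactic.RingSolver using (solve-∀)

  Σpairs : ℕ → (ℕ → ℕ → ℕ) → ℕ
  Σpairs zero    T = T 0 0
  Σpairs (suc n) T = T 0 (suc n) + Σpairs n (λ a b → T (suc a) b)

  ΣpairsPred : ℕ → (ℕ → ℕ → ℕ) → ℕ
  ΣpairsPred zero    T = 0
  ΣpairsPred (suc m) T = Σpairs m T

  Σpairs-cong : ∀ n {T U : ℕ → ℕ → ℕ} → (∀ a b → a + b ≡ n → T a b ≡ U a b) → Σpairs n T ≡ Σpairs n U
  Σpairs-cong zero    p = p 0 0 refl
  Σpairs-cong (suc n) p = cong₂ _+_ (p 0 (suc n) refl) (Σpairs-cong n (λ a b e → p (suc a) b (cong suc e)))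

  ΣpairsPred-cong : ∀ m {T U : ℕ → ℕ → ℕ} → (∀ a b → suc (a + b) ≡ m → T a b ≡ U a b) →
                    ΣpairsPred m T ≡ ΣpairsPred m U
  ΣpairsPred-cong zero    p = refl
  ΣpairsPred-cong (suc m) p = Σpairs-cong m (λ a b e → p a b (cong suc e))

  Σpairs-+ : ∀ n T U → Σpairs n (λ a b → T a b + U a b) ≡ Σpairs n T + Σpairs n U
  Σpairs-+ zero    T U = refl
  Σpairs-+ (suc n) T U rewrite Σpairs-+ n (λ a b → T (suc a) b) (λ a b → U (suc a) b) =
    interchange (T 0 (suc n)) (U 0 (suc n)) (Σpairs n (λ a b → T (suc a) b)) (Σpairs n (λ a b → U (suc a) b))
    where
    interchange : ∀ x y X Y → (x + y) + (X + Y) ≡ (x + X) + (y + Y)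
    interchange = solve-∀

  Σpairs-*ˡ : ∀ n c T → Σpairs n (λ a b → c * T a b) ≡ c * Σpairs n T
  Σpairs-*ˡ zero    c T = refl
  Σpairs-*ˡ (suc n) c T rewrite Σpairs-*ˡ n c (λ a b → T (suc a) b) = sym (*-distribˡ-+ c _ _)

  Σpairs-*ʳ : ∀ n c T → Σpairs n (λ a b → T a b * c) ≡ Σpairs n T * c
  Σpairs-*ʳ zero    c T = refl
  Σpairs-*ʳ (suc n) c T rewrite Σpairs-*ʳ n c (λ a b → T (suc a) b) = sym (*-distribʳ-+ c (T 0 (suc n)) _)

  ΣpairsPred-*ˡ : ∀ m c T → ΣpairsPred m (λ a b → c * T a b) ≡ c * ΣpairsPred m T
  ΣpairsPred-*ˡ zero    c T = sym (*-zeroʳ c)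
  ΣpairsPred-*ˡ (suc m) c T = Σpairs-*ˡ m c T

  Σpairs-first : ∀ m T → Σpairs m T ≡ T 0 m + ΣpairsPred m (λ a b → T (suc a) b)
  Σpairs-first zero    T = sym (+-identityʳ _)
  Σpairs-first (suc m) T = refl

  Σpairs-last : ∀ m T → Σpairs m T ≡ ΣpairsPred m (λ a b → T a (suc b)) + T m 0
  Σpairs-last zero    T = refl
  Σpairs-last (suc m) T rewrite Σpairs-last m (λ a b → T (suc a) b) | Σpairs-first m (λ a b → T a (suc b)) =
    sym (+-assoc (T 0 (suc m)) _ (T (suc m) 0))

  Σpairs-assoc : ∀ n (T : ℕ → ℕ → ℕ → ℕ) →
    Σpairs n (λ a b → Σpairs b (λ k l → T a k l)) ≡ Σpairs n (λ p l → Σpairs p (λ a k → T a k l))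
  Σpairs-assoc zero    T = refl
  Σpairs-assoc (suc n) T
    rewrite Σpairs-assoc n (λ a k l → T (suc a) k l)
          | Σpairs-+ n (λ p l → T 0 (suc p) l) (λ p l → Σpairs p (λ a k → T (suc a) k l)) =
    +-assoc (T 0 0 (suc n)) _ _

  Σpairs-ΣpairsPred-assoc : ∀ n (T : ℕ → ℕ → ℕ → ℕ) →
    Σpairs n (λ a b → ΣpairsPred a (λ k l → T k l b)) ≡ Σpairs n (λ k m → ΣpairsPred m (λ l b → T k l b))
  Σpairs-ΣpairsPred-assoc zero    T = refl
  Σpairs-ΣpairsPred-assoc (suc n) T = begin
    Σpairs (suc n) (λ a b → ΣpairsPred a (λ k l → T k l b))
      ≡⟨ Σpairs-first (suc n) (λ a b → ΣpairsPred a (λ k l → T k l b)) ⟩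
    Σpairs n (λ p l → Σpairs p (λ a k → T a k l))
      ≡⟨ Σpairs-assoc n T ⟨
    Σpairs n (λ a b → Σpairs b (λ k l → T a k l))
      ≡⟨ +-identityʳ _ ⟨
    Σpairs n (λ a b → Σpairs b (λ k l → T a k l)) + 0
      ≡⟨ Σpairs-last (suc n) (λ k m → ΣpairsPred m (λ l b → T k l b)) ⟨
    Σpairs (suc n) (λ k m → ΣpairsPred m (λ l b → T k l b))
      ∎
    where open ≡-Reasoning

  ΣpairsPred-assoc : ∀ m (T : ℕ → ℕ → ℕ → ℕ) →
    ΣpairsPred m (λ a b → ΣpairsPred a (λ k l → T k l b)) ≡ ΣpairsPred m (λ k b → ΣpairsPred b (λ l c → T k l c))
  ΣpairsPred-assoc zero    T = refl
  ΣpairsPred-assoc (suc m) T = Σpairs-ΣpairsPred-assoc m T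

module DyckSums where

  open AntidiagonalSums
  open import Data.Nat
  open import Data.Nat.Properties
  open import Data.Nat.Induction using (<-rec)
  open import Data.Bool using (Bool; true; false; if_then_else_)
  open import Data.List using (List; []; _∷_; _++_; length; concatMap)
  open import Data.List.Properties using (++-assoc)
  open import Relation.Binary.PropositionalEquality
  open import Function using (_∘_)
  open import Data.Nat.Tactic.RingSolver using (solve-∀)

  ΣDyckIn : ℕ → List (List Step) → (List Step → ℕ) → ℕ
  ΣDyckIn h []       f = 0
  ΣDyckIn h (w ∷ ws) f = (if dyckFrom h w then f w else 0) + ΣDyckIn h ws f

  ΣPaths : ℕ → ℕ → (List Step → ℕ) → ℕ
  ΣPaths h m = ΣDyckIn h (words m)

  ΣDyckIn-cong : ∀ h ws {f g} → f ≗ g → ΣDyckIn h ws f ≡ ΣDyckIn h ws g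
  ΣDyckIn-cong h []       p = refl
  ΣDyckIn-cong h (w ∷ ws) p rewrite p w | ΣDyckIn-cong h ws p = refl

  ΣDyckIn-+ : ∀ h ws f g → ΣDyckIn h ws (λ w → f w + g w) ≡ ΣDyckIn h ws f + ΣDyckIn h ws g
  ΣDyckIn-+ h []       f g = refl
  ΣDyckIn-+ h (w ∷ ws) f g with dyckFrom h w
  ... | true  rewrite ΣDyckIn-+ h ws f g = interchange (f w) (g w) (ΣDyckIn h ws f) (ΣDyckIn h ws g)
    where
    interchange : ∀ a b c e → a + b + (c + e) ≡ a + c + (b + e)
    interchange = solve-∀
  ... | false = ΣDyckIn-+ h ws f g

  ΣDyckIn-zero : ∀ h ws → ΣDyckIn h ws (λ _ → 0) ≡ 0
  ΣDyckIn-zero h []       = refl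
  ΣDyckIn-zero h (w ∷ ws) with dyckFrom h w
  ... | true  = ΣDyckIn-zero h ws
  ... | false = ΣDyckIn-zero h ws

  ΣDyckIn-*ˡ : ∀ h ws c f → ΣDyckIn h ws (λ w → c * f w) ≡ c * ΣDyckIn h ws f
  ΣDyckIn-*ˡ h []       c f = sym (*-zeroʳ c)
  ΣDyckIn-*ˡ h (w ∷ ws) c f with dyckFrom h w
  ... | true  rewrite ΣDyckIn-*ˡ h ws c f = sym (*-distribˡ-+ c (f w) (ΣDyckIn h ws f))
  ... | false = ΣDyckIn-*ˡ h ws c f

  ΣDyckIn-*ʳ : ∀ h ws c f → ΣDyckIn h ws (λ w → f w * c) ≡ ΣDyckIn h ws f * c
  ΣDyckIn-*ʳ h ws c f =
    trans (ΣDyckIn-cong h ws (λ w → *-comm (f w) c)) (trans (ΣDyckIn-*ˡ h ws c f) (*-comm c _))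

  ΣDyckIn-Σpairs : ∀ h ws n (T : List Step → ℕ → ℕ → ℕ) →
    ΣDyckIn h ws (λ w → Σpairs n (T w)) ≡ Σpairs n (λ a b → ΣDyckIn h ws (λ w → T w a b))
  ΣDyckIn-Σpairs h ws zero    T = refl
  ΣDyckIn-Σpairs h ws (suc n) T =
    trans (ΣDyckIn-+ h ws (λ w → T w 0 (suc n)) (λ w → Σpairs n (λ a b → T w (suc a) b)))
          (cong (ΣDyckIn h ws (λ w → T w 0 (suc n)) +_) (ΣDyckIn-Σpairs h ws n (λ w a b → T w (suc a) b)))

  ΣDyckIn-ΣpairsPred : ∀ h ws m (T : List Step → ℕ → ℕ → ℕ) →
    ΣDyckIn h ws (λ w → ΣpairsPred m (T w)) ≡ ΣpairsPred m (λ a b → ΣDyckIn h ws (λ w → T w a b))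
  ΣDyckIn-ΣpairsPred h ws zero    T = ΣDyckIn-zero h ws
  ΣDyckIn-ΣpairsPred h ws (suc m) T = ΣDyckIn-Σpairs h ws m T

  extend : List Step → List (List Step)
  extend w = (u ∷ w) ∷ (d ∷ w) ∷ []

  ΣDyckIn-extend₀ : ∀ ws f → ΣDyckIn 0 (concatMap extend ws) f ≡ ΣDyckIn 1 ws (f ∘ (u ∷_))
  ΣDyckIn-extend₀ []       f = refl
  ΣDyckIn-extend₀ (w ∷ ws) f = cong ((if dyckFrom 1 w then f (u ∷ w) else 0) +_) (ΣDyckIn-extend₀ ws f)

  ΣDyckIn-extend : ∀ h ws f → ΣDyckIn (suc h) (concatMap extend ws) f ≡
                   ΣDyckIn (suc (suc h)) ws (f ∘ (u ∷_)) + ΣDyckIn h ws (f ∘ (d ∷_))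
  ΣDyckIn-extend h []       f = refl
  ΣDyckIn-extend h (w ∷ ws) f rewrite ΣDyckIn-extend h ws f =
    interchange (if dyckFrom (suc (suc h)) w then f (u ∷ w) else 0) (if dyckFrom h w then f (d ∷ w) else 0)
                (ΣDyckIn (suc (suc h)) ws (f ∘ (u ∷_))) (ΣDyckIn h ws (f ∘ (d ∷_)))
    where
    interchange : ∀ a b c e → a + (b + (c + e)) ≡ (a + c) + (b + e)
    interchange = solve-∀

  ΣPaths-suc₀ : ∀ m f → ΣPaths 0 (suc m) f ≡ ΣPaths 1 m (f ∘ (u ∷_))
  ΣPaths-suc₀ m = ΣDyckIn-extend₀ (words m)

  ΣPaths-suc : ∀ h m f → ΣPaths (suc h) (suc m) f ≡ ΣPaths (suc (suc h)) m (f ∘ (u ∷_)) + ΣPaths h m (f ∘ (d ∷_))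
  ΣPaths-suc h m = ΣDyckIn-extend h (words m)

  ΣPaths-cong : ∀ m h {f g} → f ≗ g → ΣPaths h m f ≡ ΣPaths h m g
  ΣPaths-cong m h = ΣDyckIn-cong h (words m)

  ΣPaths-congOnPaths : ∀ m h {f g} → (∀ w → length w ≡ m → dyckFrom h w ≡ true → f w ≡ g w) →
                       ΣPaths h m f ≡ ΣPaths h m g
  ΣPaths-congOnPaths zero    zero    p = cong (_+ 0) (p [] refl refl)
  ΣPaths-congOnPaths zero    (suc h) p = refl
  ΣPaths-congOnPaths (suc m) zero    {f} {g} p rewrite ΣPaths-suc₀ m f | ΣPaths-suc₀ m g =
    ΣPaths-congOnPaths m 1 (λ w l e → p (u ∷ w) (cong suc l) e)
  ΣPaths-congOnPaths (suc m) (suc h) {f} {g} p rewrite ΣPaths-suc h m f | ΣPaths-suc h m g =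
    cong₂ _+_ (ΣPaths-congOnPaths m (suc (suc h)) (λ w l e → p (u ∷ w) (cong suc l) e))
              (ΣPaths-congOnPaths m h (λ w l e → p (d ∷ w) (cong suc l) e))

  even : ℕ → Bool
  even zero          = true
  even (suc zero)    = false
  even (suc (suc n)) = even n

  ΣPaths-odd : ∀ m h f → even (m + h) ≡ false → ΣPaths h m f ≡ 0
  ΣPaths-odd zero    zero    f ()
  ΣPaths-odd zero    (suc h) f _ = refl
  ΣPaths-odd (suc m) zero    f odd rewrite ΣPaths-suc₀ m f =
    ΣPaths-odd m 1 _ (trans (cong even (+-comm m 1)) (trans (cong (even ∘ suc) (sym (+-identityʳ m))) odd))
  ΣPaths-odd (suc m) (suc h) f odd rewrite ΣPaths-suc h m f =
    cong₂ _+_ (ΣPaths-odd m (suc (suc h)) _ (trans (cong even (trans (+-suc m (suc h)) (cong suc (+-suc m h)))) odd′))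
              (ΣPaths-odd m h _ odd′)
    where
    odd′ : even (m + h) ≡ false
    odd′ = trans (cong (even ∘ suc) (sym (+-suc m h))) odd

  FirstDescent : ℕ → Set
  FirstDescent m = ∀ h f →
    ΣPaths (suc h) m f ≡ ΣpairsPred m (λ a b → ΣPaths 0 a (λ A → ΣPaths h b (λ B → f (A ++ d ∷ B))))

  ΣPaths-firstDescent : ∀ m → FirstDescent m
  ΣPaths-firstDescent = <-rec FirstDescent step
    where
    left< : ∀ a b {m} → suc (a + b) ≡ m → a < suc m
    left< a b refl = s≤s (≤-trans (m≤m+n a b) (n≤1+n _))
    right< : ∀ a b {m} → suc (a + b) ≡ m → b < suc m
    right< a b refl = s≤s (≤-trans (m≤n+m b a) (n≤1+n _))

    step : ∀ m → (∀ {m′} → m′ < m → FirstDescent m′) → FirstDescent m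
    step zero    _   h f = refl
    step (suc m) rec h f = begin
        ΣPaths (suc h) (suc m) f
      ≡⟨ ΣPaths-suc h m f ⟩
        ΣPaths (suc (suc h)) m (f ∘ (u ∷_)) + ΣPaths h m (f ∘ (d ∷_))
      ≡⟨ +-comm _ (ΣPaths h m (f ∘ (d ∷_))) ⟩
        ΣPaths h m (f ∘ (d ∷_)) + ΣPaths (suc (suc h)) m (f ∘ (u ∷_))
      ≡⟨ cong₂ _+_ (sym (+-identityʳ _)) climbsFirst ⟩
        Piece 0 m + ΣpairsPred m (λ a b → Piece (suc a) b)
      ≡⟨ Σpairs-first m Piece ⟨
        ΣpairsPred (suc m) Piece
      ∎
      where
      open ≡-Reasoning
      Piece : ℕ → ℕ → ℕ
      Piece a b = ΣPaths 0 a (λ A → ΣPaths h b (λ B → f (A ++ d ∷ B)))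
      Nested : ℕ → ℕ → ℕ → ℕ
      Nested a₁ b₁ b = ΣPaths 0 a₁ (λ A₁ → ΣPaths 0 b₁ (λ B₁ → ΣPaths h b (λ B → f (u ∷ (A₁ ++ d ∷ B₁) ++ d ∷ B))))
      Piece-suc : ∀ a b → suc (a + b) ≡ m → Piece (suc a) b ≡ ΣpairsPred a (λ a₁ b₁ → Nested a₁ b₁ b)
      Piece-suc a b e = trans (ΣPaths-suc₀ a _) (rec (left< a b e) 0 _)
      inner : ∀ a b′ → suc (a + b′) ≡ m →
        ΣPaths 0 a (λ A → ΣPaths (suc h) b′ (λ B′ → f (u ∷ A ++ d ∷ B′))) ≡ ΣpairsPred b′ (λ a₂ b → Nested a a₂ b)
      inner a b′ e = begin
          ΣPaths 0 a (λ A → ΣPaths (suc h) b′ (λ B′ → f (u ∷ A ++ d ∷ B′)))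
        ≡⟨ ΣPaths-cong a 0 (λ A → rec (right< a b′ e) h _) ⟩
          ΣPaths 0 a (λ A → ΣpairsPred b′ (λ a₂ b → ΣPaths 0 a₂ (λ A₂ → ΣPaths h b (λ B → f (u ∷ A ++ d ∷ A₂ ++ d ∷ B)))))
        ≡⟨ ΣDyckIn-ΣpairsPred 0 (words a) b′ _ ⟩
          ΣpairsPred b′ (λ a₂ b → ΣPaths 0 a (λ A → ΣPaths 0 a₂ (λ A₂ → ΣPaths h b (λ B → f (u ∷ A ++ d ∷ A₂ ++ d ∷ B)))))
        ≡⟨ ΣpairsPred-cong b′ (λ a₂ b _ → ΣPaths-cong a 0 (λ A → ΣPaths-cong a₂ 0 (λ A₂ → ΣPaths-cong b h
             (λ B → cong (f ∘ (u ∷_)) (sym (++-assoc A (d ∷ A₂) (d ∷ B))))))) ⟩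
          ΣpairsPred b′ (λ a₂ b → Nested a a₂ b)
        ∎
      climbsFirst : ΣPaths (suc (suc h)) m (f ∘ (u ∷_)) ≡ ΣpairsPred m (λ a b → Piece (suc a) b)
      climbsFirst = begin
          ΣPaths (suc (suc h)) m (f ∘ (u ∷_))
        ≡⟨ rec ≤-refl (suc h) _ ⟩
          ΣpairsPred m (λ a b′ → ΣPaths 0 a (λ A → ΣPaths (suc h) b′ (λ B′ → f (u ∷ A ++ d ∷ B′))))
        ≡⟨ ΣpairsPred-cong m inner ⟩
          ΣpairsPred m (λ a b′ → ΣpairsPred b′ (λ a₂ b → Nested a a₂ b))
        ≡⟨ ΣpairsPred-assoc m Nested ⟨
          ΣpairsPred m (λ a b → ΣpairsPred a (λ a₁ b₁ → Nested a₁ b₁ b))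
        ≡⟨ ΣpairsPred-cong m (λ a b e → sym (Piece-suc a b e)) ⟩
          ΣpairsPred m (λ a b → Piece (suc a) b)
        ∎

  double : ℕ → ℕ
  double zero    = 0
  double (suc n) = suc (suc (double n))

  even-suc-double : ∀ k → even (suc (double k)) ≡ false
  even-suc-double zero    = refl
  even-suc-double (suc k) = even-suc-double k

  Σpairs-double : ∀ n (T : ℕ → ℕ → ℕ) → (∀ a b → T (suc (double a)) b ≡ 0) →
                  Σpairs (double n) T ≡ Σpairs n (λ k l → T (double k) (double l))
  Σpairs-double zero    T p = refl
  Σpairs-double (suc n) T p rewrite p 0 (suc (double n)) =
    cong (T 0 (suc (suc (double n))) +_) (Σpairs-double n (λ a b → T (suc (suc a)) b) (λ a b → p (suc a) b))

  ΣDyck : ℕ → (List Step → ℕ) → ℕ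
  ΣDyck n = ΣPaths 0 (double n)

  ΣDyck-firstReturn : ∀ n f → ΣDyck (suc n) f ≡ Σpairs n (λ k l → ΣDyck k (λ A → ΣDyck l (λ B → f (u ∷ A ++ d ∷ B))))
  ΣDyck-firstReturn n f =
    trans (ΣPaths-suc₀ (suc (double n)) f)
   (trans (ΣPaths-firstDescent (suc (double n)) 0 (f ∘ (u ∷_)))
          (Σpairs-double n _ (λ a b → ΣPaths-odd (suc (double a)) 0 _
             (trans (cong even (+-identityʳ (suc (double a)))) (even-suc-double a)))))

  ΣDyck-cong : ∀ n {f g} → f ≗ g → ΣDyck n f ≡ ΣDyck n g
  ΣDyck-cong n = ΣPaths-cong (double n) 0

  ΣDyck-congOnDyck : ∀ n {f g} → (∀ w → length w ≡ double n → isDyck w ≡ true → f w ≡ g w) →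
                     ΣDyck n f ≡ ΣDyck n g
  ΣDyck-congOnDyck n = ΣPaths-congOnPaths (double n) 0

  ΣDyck-+ : ∀ n f g → ΣDyck n (λ w → f w + g w) ≡ ΣDyck n f + ΣDyck n g
  ΣDyck-+ n = ΣDyckIn-+ 0 (words (double n))

  ΣDyck-zero : ∀ n → ΣDyck n (λ _ → 0) ≡ 0
  ΣDyck-zero n = ΣDyckIn-zero 0 (words (double n))

  ΣDyck-*ˡ : ∀ n c f → ΣDyck n (λ w → c * f w) ≡ c * ΣDyck n f
  ΣDyck-*ˡ n = ΣDyckIn-*ˡ 0 (words (double n))

  ΣDyck-*ʳ : ∀ n c f → ΣDyck n (λ w → f w * c) ≡ ΣDyck n f * c
  ΣDyck-*ʳ n = ΣDyckIn-*ʳ 0 (words (double n))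

  ΣDyck-Σpairs : ∀ n m (T : List Step → ℕ → ℕ → ℕ) →
    ΣDyck n (λ w → Σpairs m (T w)) ≡ Σpairs m (λ a b → ΣDyck n (λ w → T w a b))
  ΣDyck-Σpairs n = ΣDyckIn-Σpairs 0 (words (double n))

module SymmetricValleys where

  open import Data.Nat
  open import Data.Bool using (Bool; true; false; if_then_else_)
  open import Data.List using (List; []; _∷_; _++_; replicate)
  open import Data.List.Properties using (++-identityʳ)
  open import Data.Product using (Σ-syntax; _,_)
  open import Data.Sum using (_⊎_; inj₁; inj₂)
  open import Relation.Binary.PropositionalEquality
  open import Data.Nat.Tactic.RingSolver using (solve-∀)

  iverson : Bool → ℕ
  iverson b = if b then 1 else 0

  leadingDs leadingUs : List Step → ℕ
  leadingDs (d ∷ w) = suc (leadingDs w)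
  leadingDs _       = 0
  leadingUs (u ∷ w) = suc (leadingUs w)
  leadingUs _       = 0

  dropLeadingDs dropLeadingUs : List Step → List Step
  dropLeadingDs (d ∷ w) = dropLeadingDs w
  dropLeadingDs w       = w
  dropLeadingUs (u ∷ w) = dropLeadingUs w
  dropLeadingUs w       = w

  allDs : List Step → Bool
  allDs []      = true
  allDs (u ∷ w) = false
  allDs (d ∷ w) = allDs w

  trailingDs : List Step → ℕ
  trailingDs []      = 0
  trailingDs (u ∷ w) = trailingDs w
  trailingDs (d ∷ w) = if allDs w then suc (trailingDs w) else trailingDs w

  NoLeadingD : List Step → Set
  NoLeadingD B = B ≡ [] ⊎ Σ[ v ∈ List Step ] B ≡ u ∷ v

  runs-d∷ : ∀ w → runs (d ∷ w) ≡ (d , suc (leadingDs w)) ∷ runs (dropLeadingDs w)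
  runs-u∷ : ∀ w → runs (u ∷ w) ≡ (u , suc (leadingUs w)) ∷ runs (dropLeadingUs w)
  runs-d∷ []      = refl
  runs-d∷ (u ∷ w) rewrite runs-u∷ w = refl
  runs-d∷ (d ∷ w) rewrite runs-d∷ w = refl
  runs-u∷ []      = refl
  runs-u∷ (d ∷ w) rewrite runs-d∷ w = refl
  runs-u∷ (u ∷ w) rewrite runs-u∷ w = refl

  sval-u∷ : ∀ w → sval (u ∷ w) ≡ sval w
  sval-u∷ []      = refl
  sval-u∷ (d ∷ w) rewrite runs-u∷ (d ∷ w) = refl
  sval-u∷ (u ∷ w) rewrite runs-u∷ (u ∷ w) | runs-u∷ w = refl

  leadingDs-ds++ : ∀ j B → NoLeadingD B → leadingDs (replicate j d ++ B) ≡ j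
  leadingDs-ds++ zero    .[]      (inj₁ refl)       = refl
  leadingDs-ds++ zero    .(u ∷ v) (inj₂ (v , refl)) = refl
  leadingDs-ds++ (suc j) B        nd                = cong suc (leadingDs-ds++ j B nd)

  dropLeadingDs-ds++ : ∀ j B → NoLeadingD B → dropLeadingDs (replicate j d ++ B) ≡ B
  dropLeadingDs-ds++ zero    .[]      (inj₁ refl)       = refl
  dropLeadingDs-ds++ zero    .(u ∷ v) (inj₂ (v , refl)) = refl
  dropLeadingDs-ds++ (suc j) B        nd                = dropLeadingDs-ds++ j B nd

  sval-ds++ : ∀ j B → NoLeadingD B → sval (replicate (suc j) d ++ B) ≡ iverson (suc j ≡ᵇ leadingUs B) + sval B
  sval-ds++ j B nd rewrite runs-d∷ (replicate j d ++ B) | leadingDs-ds++ j B nd | dropLeadingDs-ds++ j B nd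
    with nd
  ... | inj₁ refl       = refl
  ... | inj₂ (v , refl) rewrite runs-u∷ v = refl

  sval-ds : ∀ j → sval (replicate j d) ≡ 0
  sval-ds zero    = refl
  sval-ds (suc j) = trans (cong sval (sym (++-identityʳ (replicate (suc j) d)))) (sval-ds++ j [] (inj₁ refl))

  allDs-ds : ∀ j → allDs (replicate j d) ≡ true
  allDs-ds zero    = refl
  allDs-ds (suc j) = allDs-ds j

  trailingDs-ds : ∀ j → trailingDs (replicate j d) ≡ j
  trailingDs-ds zero    = refl
  trailingDs-ds (suc j) rewrite allDs-ds j | trailingDs-ds j = refl

  allDs-++ : ∀ y z → allDs z ≡ false → allDs (y ++ z) ≡ false
  allDs-++ []      z e = e
  allDs-++ (u ∷ y) z e = refl
  allDs-++ (d ∷ y) z e = allDs-++ y z e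

  trailingDs-++ : ∀ y z → allDs z ≡ false → trailingDs (y ++ z) ≡ trailingDs z
  trailingDs-++ []      z e = refl
  trailingDs-++ (u ∷ y) z e = trailingDs-++ y z e
  trailingDs-++ (d ∷ y) z e rewrite allDs-++ y z e = trailingDs-++ y z e

  allDs-∷ʳd : ∀ x → allDs (x ++ d ∷ []) ≡ allDs x
  allDs-∷ʳd []      = refl
  allDs-∷ʳd (u ∷ x) = refl
  allDs-∷ʳd (d ∷ x) = allDs-∷ʳd x

  trailingDs-∷ʳd : ∀ x → trailingDs (x ++ d ∷ []) ≡ suc (trailingDs x)
  trailingDs-∷ʳd []      = refl
  trailingDs-∷ʳd (u ∷ x) = trailingDs-∷ʳd x
  trailingDs-∷ʳd (d ∷ x) rewrite allDs-∷ʳd x | trailingDs-∷ʳd x with allDs x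
  ... | true  = refl
  ... | false = refl

  leadingUs-++d∷ : ∀ x B → leadingUs (x ++ d ∷ B) ≡ leadingUs x
  leadingUs-++d∷ []      B = refl
  leadingUs-++d∷ (u ∷ x) B = cong suc (leadingUs-++d∷ x B)
  leadingUs-++d∷ (d ∷ x) B = refl

  ds++d∷ : ∀ j w → replicate j d ++ d ∷ w ≡ d ∷ replicate j d ++ w
  ds++d∷ zero    w = refl
  ds++d∷ (suc j) w = cong (d ∷_) (ds++d∷ j w)

  sval-++d∷ : ∀ x B → NoLeadingD B →
    sval (x ++ d ∷ B) ≡ sval x + iverson (suc (trailingDs x) ≡ᵇ leadingUs B) + sval B
  sval-++d∷ x B nd = afterDs 0 x
    where
    joint : List Step → ℕ
    joint x = iverson (suc (trailingDs x) ≡ᵇ leadingUs B)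

    afterDs : ∀ j x → sval (replicate j d ++ x ++ d ∷ B) ≡
                      sval (replicate j d ++ x) + joint (replicate j d ++ x) + sval B
    afterDs j [] rewrite ++-identityʳ (replicate j d) | ds++d∷ j B | sval-ds j | trailingDs-ds j =
      sval-ds++ j B nd
    afterDs j (d ∷ x) rewrite ds++d∷ j (x ++ d ∷ B) | ds++d∷ j x = afterDs (suc j) x
    afterDs zero (u ∷ x) rewrite sval-u∷ (x ++ d ∷ B) | sval-u∷ x = afterDs 0 x
    afterDs (suc j) (u ∷ x) = begin
        sval (replicate (suc j) d ++ u ∷ x ++ d ∷ B)
      ≡⟨ sval-ds++ j (u ∷ x ++ d ∷ B) (inj₂ (_ , refl)) ⟩
        iverson (suc j ≡ᵇ suc (leadingUs (x ++ d ∷ B))) + sval (u ∷ x ++ d ∷ B)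
      ≡⟨ cong₂ (λ k s → iverson (suc j ≡ᵇ suc k) + s) (leadingUs-++d∷ x B) (sval-u∷ (x ++ d ∷ B)) ⟩
        iverson (suc j ≡ᵇ suc (leadingUs x)) + sval (x ++ d ∷ B)
      ≡⟨ cong (iverson (suc j ≡ᵇ suc (leadingUs x)) +_) (afterDs 0 x) ⟩
        iverson (suc j ≡ᵇ suc (leadingUs x)) + (sval x + joint x + sval B)
      ≡⟨ reassoc (iverson (suc j ≡ᵇ suc (leadingUs x))) (sval x) (joint x) (sval B) ⟩
        iverson (suc j ≡ᵇ suc (leadingUs x)) + sval x + joint x + sval B
      ≡⟨ cong₂ (λ s k → s + iverson (suc k ≡ᵇ leadingUs B) + sval B) sval-prefix trailing-prefix ⟨
        sval (replicate (suc j) d ++ u ∷ x) + joint (replicate (suc j) d ++ u ∷ x) + sval B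
      ∎
      where
      open ≡-Reasoning
      reassoc : ∀ a s k b → a + (s + k + b) ≡ a + s + k + b
      reassoc = solve-∀
      sval-prefix : sval (replicate (suc j) d ++ u ∷ x) ≡ iverson (suc j ≡ᵇ suc (leadingUs x)) + sval x
      sval-prefix = trans (sval-ds++ j (u ∷ x) (inj₂ (x , refl))) (cong (iverson (suc j ≡ᵇ suc (leadingUs x)) +_) (sval-u∷ x))
      trailing-prefix : trailingDs (replicate (suc j) d ++ u ∷ x) ≡ trailingDs x
      trailing-prefix = trailingDs-++ (replicate (suc j) d) (u ∷ x) refl

module Recurrences where

  open AntidiagonalSums
  open DyckSums
  open SymmetricValleys
  open import Data.Nat
  open import Data.Nat.Properties
  open import Data.Bool using (true)
  open import Data.List using (List; []; _∷_; _++_; length)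
  open import Data.Product using (Σ-syntax; _,_)
  open import Data.Sum using (inj₁; inj₂)
  open import Relation.Binary.PropositionalEquality
  open import Data.Nat.Tactic.RingSolver using (solve-∀)

  catalan svalTotal : ℕ → ℕ
  catalan n   = ΣDyck n (λ _ → 1)
  svalTotal n = ΣDyck n sval

  symmetricJoin runsMatch : List Step → List Step → ℕ
  symmetricJoin A B = iverson (suc (trailingDs A) ≡ᵇ leadingUs B)
  runsMatch     A B = iverson (trailingDs A ≡ᵇ leadingUs B)

  joinPairs matchPairs : ℕ → ℕ → ℕ
  joinPairs  a b = ΣDyck a (λ A → ΣDyck b (symmetricJoin A))
  matchPairs a b = ΣDyck a (λ A → ΣDyck b (runsMatch A))

  joinTotal matchTotal matchTotal⁺ : ℕ → ℕ
  joinTotal  n  = Σpairs n joinPairs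
  matchTotal n  = Σpairs n matchPairs
  matchTotal⁺ m = ΣpairsPred m (λ a b → matchPairs (suc a) b)

  dyck⇒NoLeadingD : ∀ B → isDyck B ≡ true → NoLeadingD B
  dyck⇒NoLeadingD []      _ = inj₁ refl
  dyck⇒NoLeadingD (u ∷ v) _ = inj₂ (v , refl)

  nonemptyDyck⇒u∷ : ∀ m B → length B ≡ suc m → isDyck B ≡ true → Σ[ v ∈ List Step ] B ≡ u ∷ v
  nonemptyDyck⇒u∷ m (u ∷ v) _ _ = v , refl

  ΣDyck-const : ∀ n c → ΣDyck n (λ _ → c) ≡ c * catalan n
  ΣDyck-const n c = trans (ΣDyck-cong n (λ _ → sym (*-identityʳ c))) (ΣDyck-*ˡ n c (λ _ → 1))

  catalan-suc : ∀ n → catalan (suc n) ≡ Σpairs n (λ k l → catalan k * catalan l)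
  catalan-suc n = trans (ΣDyck-firstReturn n (λ _ → 1))
    (Σpairs-cong n (λ k l _ → trans (ΣDyck-const k (catalan l)) (*-comm (catalan l) (catalan k))))

  svalTotal-firstReturn : ∀ k l → ΣDyck k (λ A → ΣDyck l (λ B → sval (u ∷ A ++ d ∷ B))) ≡
                          svalTotal k * catalan l + catalan k * svalTotal l + joinPairs k l
  svalTotal-firstReturn k l = begin
      ΣDyck k (λ A → ΣDyck l (λ B → sval (u ∷ A ++ d ∷ B)))
    ≡⟨ ΣDyck-cong k (λ A → ΣDyck-congOnDyck l (λ B _ dyck →
         trans (sval-u∷ (A ++ d ∷ B)) (sval-++d∷ A B (dyck⇒NoLeadingD B dyck)))) ⟩
      ΣDyck k (λ A → ΣDyck l (λ B → sval A + symmetricJoin A B + sval B))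
    ≡⟨ ΣDyck-cong k inner ⟩
      ΣDyck k (λ A → sval A * catalan l + ΣDyck l (symmetricJoin A) + svalTotal l)
    ≡⟨ ΣDyck-+ k _ (λ _ → svalTotal l) ⟩
      ΣDyck k (λ A → sval A * catalan l + ΣDyck l (symmetricJoin A)) + ΣDyck k (λ _ → svalTotal l)
    ≡⟨ cong₂ _+_ (trans (ΣDyck-+ k (λ A → sval A * catalan l) _) (cong (_+ joinPairs k l) (ΣDyck-*ʳ k (catalan l) sval)))
                 (ΣDyck-const k (svalTotal l)) ⟩
      svalTotal k * catalan l + joinPairs k l + svalTotal l * catalan k
    ≡⟨ rearrange (svalTotal k * catalan l) (joinPairs k l) (svalTotal l) (catalan k) ⟩
      svalTotal k * catalan l + catalan k * svalTotal l + joinPairs k l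
    ∎
    where
    open ≡-Reasoning
    rearrange : ∀ a j s c → a + j + s * c ≡ a + c * s + j
    rearrange = solve-∀
    inner : ∀ A → ΣDyck l (λ B → sval A + symmetricJoin A B + sval B) ≡
                  sval A * catalan l + ΣDyck l (symmetricJoin A) + svalTotal l
    inner A = trans (ΣDyck-+ l (λ B → sval A + symmetricJoin A B) sval)
                    (cong (_+ svalTotal l) (trans (ΣDyck-+ l (λ _ → sval A) (symmetricJoin A))
                                                  (cong (_+ ΣDyck l (symmetricJoin A)) (ΣDyck-const l (sval A)))))

  svalTotal-suc : ∀ n → svalTotal (suc n) ≡
    Σpairs n (λ k l → svalTotal k * catalan l) + Σpairs n (λ k l → catalan k * svalTotal l) + joinTotal n
  svalTotal-suc n = begin
      svalTotal (suc n)
    ≡⟨ ΣDyck-firstReturn n sval ⟩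
      Σpairs n (λ k l → ΣDyck k (λ A → ΣDyck l (λ B → sval (u ∷ A ++ d ∷ B))))
    ≡⟨ Σpairs-cong n (λ k l _ → svalTotal-firstReturn k l) ⟩
      Σpairs n (λ k l → svalTotal k * catalan l + catalan k * svalTotal l + joinPairs k l)
    ≡⟨ Σpairs-+ n (λ k l → svalTotal k * catalan l + catalan k * svalTotal l) joinPairs ⟩
      Σpairs n (λ k l → svalTotal k * catalan l + catalan k * svalTotal l) + joinTotal n
    ≡⟨ cong (_+ joinTotal n) (Σpairs-+ n (λ k l → svalTotal k * catalan l) (λ k l → catalan k * svalTotal l)) ⟩
      Σpairs n (λ k l → svalTotal k * catalan l) + Σpairs n (λ k l → catalan k * svalTotal l) + joinTotal n
    ∎
    where open ≡-Reasoning

  joinPairs-suc : ∀ a b → joinPairs a (suc b) ≡ Σpairs b (λ k l → matchPairs a k * catalan l)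
  joinPairs-suc a b = begin
      ΣDyck a (λ A → ΣDyck (suc b) (symmetricJoin A))
    ≡⟨ ΣDyck-cong a (λ A → trans (ΣDyck-firstReturn b (symmetricJoin A)) (Σpairs-cong b (λ k l _ → split A k l))) ⟩
      ΣDyck a (λ A → Σpairs b (λ k l → ΣDyck k (runsMatch A) * catalan l))
    ≡⟨ ΣDyck-Σpairs a b (λ A k l → ΣDyck k (runsMatch A) * catalan l) ⟩
      Σpairs b (λ k l → ΣDyck a (λ A → ΣDyck k (runsMatch A) * catalan l))
    ≡⟨ Σpairs-cong b (λ k l _ → ΣDyck-*ʳ a (catalan l) (λ A → ΣDyck k (runsMatch A))) ⟩
      Σpairs b (λ k l → matchPairs a k * catalan l)
    ∎
    where
    open ≡-Reasoning
    split : ∀ A k l → ΣDyck k (λ B₁ → ΣDyck l (λ B₂ → symmetricJoin A (u ∷ B₁ ++ d ∷ B₂))) ≡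
                      ΣDyck k (runsMatch A) * catalan l
    split A k l = trans (ΣDyck-cong k (λ B₁ →
        trans (ΣDyck-cong l (λ B₂ → cong (λ m → iverson (trailingDs A ≡ᵇ m)) (leadingUs-++d∷ B₁ B₂)))
              (ΣDyck-const l (runsMatch A B₁))))
      (ΣDyck-*ʳ k (catalan l) (runsMatch A))

  joinTotal-suc : ∀ n → joinTotal (suc n) ≡ Σpairs n (λ k l → matchTotal k * catalan l)
  joinTotal-suc n = begin
      joinTotal (suc n)
    ≡⟨ Σpairs-last (suc n) joinPairs ⟩
      Σpairs n (λ a b → joinPairs a (suc b)) + ΣDyck (suc n) (λ _ → 0)
    ≡⟨ cong₂ _+_ (Σpairs-cong n (λ a b _ → joinPairs-suc a b)) (ΣDyck-zero (suc n)) ⟩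
      Σpairs n (λ a b → Σpairs b (λ k l → matchPairs a k * catalan l)) + 0
    ≡⟨ +-identityʳ _ ⟩
      Σpairs n (λ a b → Σpairs b (λ k l → matchPairs a k * catalan l))
    ≡⟨ Σpairs-assoc n (λ a k l → matchPairs a k * catalan l) ⟩
      Σpairs n (λ p l → Σpairs p (λ a k → matchPairs a k * catalan l))
    ≡⟨ Σpairs-cong n (λ p l _ → Σpairs-*ʳ p (catalan l) matchPairs) ⟩
      Σpairs n (λ k l → matchTotal k * catalan l)
    ∎
    where open ≡-Reasoning

  matchPairs-zero-suc : ∀ m → matchPairs 0 (suc m) ≡ 0
  matchPairs-zero-suc m = trans (+-identityʳ _)
    (trans (ΣDyck-congOnDyck (suc m) {g = λ _ → 0} unmatched) (ΣDyck-zero (suc m)))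
    where
    unmatched : ∀ B → length B ≡ double (suc m) → isDyck B ≡ true → runsMatch [] B ≡ 0
    unmatched B len dyck with nonemptyDyck⇒u∷ _ B len dyck
    ... | v , refl = refl

  matchTotal-split : ∀ m → matchTotal m ≡ iverson (m ≡ᵇ 0) + matchTotal⁺ m
  matchTotal-split zero    = refl
  matchTotal-split (suc m) = trans (Σpairs-first (suc m) matchPairs) (cong (_+ matchTotal⁺ (suc m)) (matchPairs-zero-suc m))

  matchTotal-suc : ∀ n → matchTotal (suc n) ≡ joinTotal n + Σpairs n (λ k m → catalan k * matchTotal⁺ m)
  matchTotal-suc n = begin
      matchTotal (suc n)
    ≡⟨ cong (_+ Σpairs n (λ a b → matchPairs (suc a) b)) (matchPairs-zero-suc n) ⟩
      Σpairs n (λ a b → matchPairs (suc a) b)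
    ≡⟨ Σpairs-cong n (λ a b _ → trans (ΣDyck-firstReturn a _) (Σpairs-last a _)) ⟩
      Σpairs n (λ a b → ΣpairsPred a (λ k l → Nested b k (suc l)) + Nested b a 0)
    ≡⟨ Σpairs-cong n (λ a b _ → cong₂ _+_ (ΣpairsPred-cong a (λ k l _ → nonemptyTail b k l)) (emptyTail b a)) ⟩
      Σpairs n (λ a b → ΣpairsPred a (λ k l → catalan k * matchPairs (suc l) b) + joinPairs a b)
    ≡⟨ Σpairs-+ n (λ a b → ΣpairsPred a (λ k l → catalan k * matchPairs (suc l) b)) joinPairs ⟩
      Σpairs n (λ a b → ΣpairsPred a (λ k l → catalan k * matchPairs (suc l) b)) + joinTotal n
    ≡⟨ +-comm _ (joinTotal n) ⟩
      joinTotal n + Σpairs n (λ a b → ΣpairsPred a (λ k l → catalan k * matchPairs (suc l) b))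
    ≡⟨ cong (joinTotal n +_) (Σpairs-ΣpairsPred-assoc n (λ k l b → catalan k * matchPairs (suc l) b)) ⟩
      joinTotal n + Σpairs n (λ k m → ΣpairsPred m (λ l b → catalan k * matchPairs (suc l) b))
    ≡⟨ cong (joinTotal n +_) (Σpairs-cong n (λ k m _ → ΣpairsPred-*ˡ m (catalan k) (λ l b → matchPairs (suc l) b))) ⟩
      joinTotal n + Σpairs n (λ k m → catalan k * matchTotal⁺ m)
    ∎
    where
    open ≡-Reasoning
    Nested : ℕ → ℕ → ℕ → ℕ
    Nested b k l = ΣDyck k (λ A₁ → ΣDyck l (λ A₂ → ΣDyck b (runsMatch (u ∷ A₁ ++ d ∷ A₂))))
    emptyTail : ∀ b a → Nested b a 0 ≡ joinPairs a b
    emptyTail b a = ΣDyck-cong a (λ A₁ → trans (+-identityʳ _)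
      (ΣDyck-cong b (λ B → cong (λ t → iverson (t ≡ᵇ leadingUs B)) (trailingDs-∷ʳd A₁))))
    nonemptyTail : ∀ b k l → Nested b k (suc l) ≡ catalan k * matchPairs (suc l) b
    nonemptyTail b k l = trans (ΣDyck-cong k (λ A₁ → ΣDyck-congOnDyck (suc l) (tailMatters A₁)))
                               (trans (ΣDyck-const k (matchPairs (suc l) b)) (*-comm _ (catalan k)))
      where
      tailMatters : ∀ A₁ A₂ → length A₂ ≡ double (suc l) → isDyck A₂ ≡ true →
                    ΣDyck b (runsMatch (u ∷ A₁ ++ d ∷ A₂)) ≡ ΣDyck b (runsMatch A₂)
      tailMatters A₁ A₂ len dyck with nonemptyDyck⇒u∷ _ A₂ len dyck
      ... | v , refl = ΣDyck-cong b (λ B → cong (λ t → iverson (t ≡ᵇ leadingUs B)) (trailingDs-++ A₁ (d ∷ u ∷ v) refl))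

module GeneratingFunctions where

  open PowerSeries
  open AntidiagonalSums
  open DyckSums using (ΣDyckIn; double)
  open Recurrences
  open import Data.Nat as ℕ using (ℕ; zero; suc)
  import Data.Nat.Properties as ℕ
  open import Data.Integer as ℤ using (ℤ; +_; _+_; _*_; -_; 0ℤ)
  import Data.Integer.Properties as ℤ
  open import Data.List using ([]; _∷_; map; filter)
  open import Data.Nat.ListAction using (sum)
  open import Data.Bool using (true; false)
  open import Relation.Nullary.Decidable using (T?)
  open import Relation.Binary.PropositionalEquality
  open import Function using (_∘_)

  gf : (ℕ → ℕ) → PS
  gf a n = + a n

  conv-gf : ∀ n a b → + Σpairs n (λ k l → a k ℕ.* b l) ≡ conv (gf a) (gf b) n
  conv-gf zero    a b = ℤ.pos-* (a 0) (b 0)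
  conv-gf (suc n) a b = trans (ℤ.pos-+ (a 0 ℕ.* b (suc n)) (Σpairs n (λ k l → a (suc k) ℕ.* b l)))
                              (cong₂ _+_ (ℤ.pos-* (a 0) (b (suc n))) (conv-gf n (a ∘ suc) b))

  gf-Σpairs : ∀ n a b → + Σpairs n (λ k l → a k ℕ.* b l) ≡ (gf a ⊛ gf b) n
  gf-Σpairs n a b = trans (conv-gf n a b) (sym (⊛≗conv (gf a) (gf b) n))

  C F G H H⁺ : PS
  C  = gf catalan
  F  = gf svalTotal
  G  = gf joinTotal
  H  = gf matchTotal
  H⁺ = gf matchTotal⁺

  svalGF≗F : svalGF ≗ F
  svalGF≗F n = cong +_ (trans (sum-filter (words (2 ℕ.* n))) (cong (λ m → ΣDyckIn 0 (words m) sval) (2*≡double n)))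
    where
    sum-filter : ∀ ws → sum (map sval (filter (λ w → T? (isDyck w)) ws)) ≡ ΣDyckIn 0 ws sval
    sum-filter []       = refl
    sum-filter (w ∷ ws) with isDyck w
    ... | true  = cong (sval w ℕ.+_) (sum-filter ws)
    ... | false = sum-filter ws
    2*≡double : ∀ n → 2 ℕ.* n ≡ double n
    2*≡double zero    = refl
    2*≡double (suc n) = cong suc (trans (ℕ.+-suc n (n ℕ.+ 0)) (cong suc (2*≡double n)))

  C-equation : C ≗ 𝟙 ⊕ (z ⊛ (C ⊛ C))
  C-equation zero    rewrite z⊛-zero (C ⊛ C) = refl
  C-equation (suc n) rewrite z⊛-suc (C ⊛ C) n =
    trans (cong +_ (catalan-suc n)) (trans (gf-Σpairs n catalan catalan) (sym (ℤ.+-identityˡ _)))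

  F-equation : F ≗ z ⊛ (((F ⊛ C) ⊕ (C ⊛ F)) ⊕ G)
  F-equation zero    rewrite z⊛-zero (((F ⊛ C) ⊕ (C ⊛ F)) ⊕ G) = refl
  F-equation (suc n) rewrite z⊛-suc (((F ⊛ C) ⊕ (C ⊛ F)) ⊕ G) n = begin
      + svalTotal (suc n)
    ≡⟨ cong +_ (svalTotal-suc n) ⟩
      + (Σpairs n (λ k l → svalTotal k ℕ.* catalan l) ℕ.+ Σpairs n (λ k l → catalan k ℕ.* svalTotal l) ℕ.+ joinTotal n)
    ≡⟨ ℤ.pos-+ (Σpairs n (λ k l → svalTotal k ℕ.* catalan l) ℕ.+ Σpairs n (λ k l → catalan k ℕ.* svalTotal l)) (joinTotal n) ⟩
      + (Σpairs n (λ k l → svalTotal k ℕ.* catalan l) ℕ.+ Σpairs n (λ k l → catalan k ℕ.* svalTotal l)) + G n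
    ≡⟨ cong (_+ G n) (ℤ.pos-+ (Σpairs n (λ k l → svalTotal k ℕ.* catalan l)) (Σpairs n (λ k l → catalan k ℕ.* svalTotal l))) ⟩
      + Σpairs n (λ k l → svalTotal k ℕ.* catalan l) + + Σpairs n (λ k l → catalan k ℕ.* svalTotal l) + G n
    ≡⟨ cong (_+ G n) (cong₂ _+_ (gf-Σpairs n svalTotal catalan) (gf-Σpairs n catalan svalTotal)) ⟩
      (F ⊛ C) n + (C ⊛ F) n + G n
    ∎
    where open ≡-Reasoning

  G-equation : G ≗ z ⊛ (H ⊛ C)
  G-equation zero    rewrite z⊛-zero (H ⊛ C) = refl
  G-equation (suc n) rewrite z⊛-suc (H ⊛ C) n = trans (cong +_ (joinTotal-suc n)) (gf-Σpairs n matchTotal catalan)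

  H⁺≗H-𝟙 : H⁺ ≗ H ⊕ (⊖ 𝟙)
  H⁺≗H-𝟙 zero    = refl
  H⁺≗H-𝟙 (suc m) rewrite matchTotal-split (suc m) = sym (ℤ.+-identityʳ _)

  H-equation : H ≗ 𝟙 ⊕ (z ⊛ (G ⊕ (C ⊛ (H ⊕ (⊖ 𝟙)))))
  H-equation zero    rewrite z⊛-zero (G ⊕ (C ⊛ (H ⊕ (⊖ 𝟙)))) = refl
  H-equation (suc n) rewrite z⊛-suc (G ⊕ (C ⊛ (H ⊕ (⊖ 𝟙)))) n = begin
      + matchTotal (suc n)
    ≡⟨ cong +_ (matchTotal-suc n) ⟩
      + (joinTotal n ℕ.+ Σpairs n (λ k m → catalan k ℕ.* matchTotal⁺ m))
    ≡⟨ ℤ.pos-+ (joinTotal n) (Σpairs n (λ k m → catalan k ℕ.* matchTotal⁺ m)) ⟩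
      G n + + Σpairs n (λ k m → catalan k ℕ.* matchTotal⁺ m)
    ≡⟨ cong (_+_ (G n)) (trans (gf-Σpairs n catalan matchTotal⁺) (⊛-cong {C} {C} (λ _ → refl) H⁺≗H-𝟙 n)) ⟩
      G n + (C ⊛ (H ⊕ (⊖ 𝟙))) n
    ≡⟨ ℤ.+-identityˡ _ ⟨
      0ℤ + (G n + (C ⊛ (H ⊕ (⊖ 𝟙))) n)
    ∎
    where open ≡-Reasoning

  ≗𝟘-⊕ : ∀ {f g} → f ≗ 𝟘 → g ≗ 𝟘 → f ⊕ g ≗ 𝟘
  ≗𝟘-⊕ p q n = cong₂ _+_ (p n) (q n)

  ≗𝟘-⊛ : ∀ f {g} → g ≗ 𝟘 → f ⊛ g ≗ 𝟘
  ≗𝟘-⊛ f {g} p n = trans (⊛-cong {f} {f} (λ _ → refl) p n) (⊛-zeroʳ f n)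

  ≗⇒⊝≗𝟘 : ∀ {f g} → f ≗ g → f ⊝ g ≗ 𝟘
  ≗⇒⊝≗𝟘 {f} {g} p n = trans (cong (_+ - g n) (p n)) (ℤ.+-inverseʳ (g n))

  ⊝≗𝟘⇒≗ : ∀ {f g} → f ⊝ g ≗ 𝟘 → f ≗ g
  ⊝≗𝟘⇒≗ {f} {g} p n = ℤ.i-j≡0⇒i≡j (f n) (g n) (p n)

  poly-quadratic : ∀ c₀ c₁ c₂ n →
    poly (c₀ ∷ c₁ ∷ c₂ ∷ []) n ≡ ((constPS c₀ ⊕ (constPS c₁ ⊛ z)) ⊕ (constPS c₂ ⊛ (z ⊛ z))) n
  poly-quadratic c₀ c₁ c₂ n rewrite constPS-⊛ c₁ z n | constPS-⊛ c₂ (z ⊛ z) n = coefficient n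
    where
    coefficient : ∀ n → poly (c₀ ∷ c₁ ∷ c₂ ∷ []) n ≡ (constPS c₀ n + c₁ * z n) + c₂ * (z ⊛ z) n
    coefficient 0 rewrite z⊛-zero z | ℤ.*-zeroʳ c₁ | ℤ.*-zeroʳ c₂ = sym (trans (ℤ.+-identityʳ _) (ℤ.+-identityʳ c₀))
    coefficient 1 rewrite z⊛-suc z 0 | ℤ.*-identityʳ c₁ | ℤ.*-zeroʳ c₂ = sym (trans (ℤ.+-identityʳ _) (ℤ.+-identityˡ c₁))
    coefficient 2 rewrite z⊛-suc z 1 | ℤ.*-zeroʳ c₁ | ℤ.*-identityʳ c₂ = sym (ℤ.+-identityˡ c₂)
    coefficient (suc (suc (suc n))) rewrite z⊛-suc z (suc (suc n)) | ℤ.*-zeroʳ c₁ | ℤ.*-zeroʳ c₂ = refl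

  denomAt : PS → PS → PS
  denomAt x S = ((𝟙 ⊕ (constPS (- + 3) ⊛ x)) ⊕ (constPS (- + 4) ⊛ (x ⊛ x))) ⊕ ((𝟙 ⊝ x) ⊛ S)

  denom≗denomAt : ∀ {S S′} → S ≗ S′ → denom S ≗ denomAt z S′
  denom≗denomAt {S} {S′} S≗S′ n =
    cong₂ _+_ (poly-quadratic (+ 1) (- + 3) (- + 4) n) (⊛-cong {g = S} one-minus-z S≗S′ n)
    where
    one-minus-z : poly (+ 1 ∷ - + 1 ∷ []) ≗ 𝟙 ⊝ z
    one-minus-z 0             = refl
    one-minus-z 1             = refl
    one-minus-z (suc (suc n)) = refl

  numer≗2z² : numer ≗ constPS (+ 2) ⊛ (z ⊛ z)
  numer≗2z² n rewrite constPS-⊛ (+ 2) (z ⊛ z) n = coefficient n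
    where
    coefficient : ∀ n → numer n ≡ + 2 * (z ⊛ z) n
    coefficient 0 rewrite z⊛-zero z = refl
    coefficient 1 rewrite z⊛-suc z 0 = refl
    coefficient 2 rewrite z⊛-suc z 1 = refl
    coefficient (suc (suc (suc n))) rewrite z⊛-suc z (suc (suc n)) = refl

  oneMinus4z≗ : oneMinus4z ≗ 𝟙 ⊝ (constPS (+ 4) ⊛ z)
  oneMinus4z≗ n rewrite constPS-⊛ (+ 4) z n = coefficient n
    where
    coefficient : ∀ n → oneMinus4z n ≡ 𝟙 n + - (+ 4 * z n)
    coefficient 0             = refl
    coefficient 1             = refl
    coefficient (suc (suc n)) = refl

  differenceOfSquares : ∀ C S x →
    let T = 𝟙 ⊝ (constPS (+ 2) ⊛ (x ⊛ C)) in
    ((S ⊝ T) ⊛ (S ⊕ T)) ≗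
    ((S ⊛ S) ⊝ (𝟙 ⊝ (constPS (+ 4) ⊛ x))) ⊕ ((constPS (+ 4) ⊛ x) ⊛ (C ⊝ (𝟙 ⊕ (x ⊛ (C ⊛ C)))))
  differenceOfSquares = solve 3 (λ C S x →
    let T = con (+ 1) :- (con (+ 2) :* (x :* C)) in
    ((S :- T) :* (S :+ T)) :=
    ((S :* S) :- (con (+ 1) :- (con (+ 4) :* x))) :+ ((con (+ 4) :* x) :* (C :- (con (+ 1) :+ (x :* (C :* C))))))
    (λ _ → refl)

  functionalEquations⇒F⊛denom : ∀ F C G H x →
    C ≗ 𝟙 ⊕ (x ⊛ (C ⊛ C)) →
    F ≗ x ⊛ (((F ⊛ C) ⊕ (C ⊛ F)) ⊕ G) →
    G ≗ x ⊛ (H ⊛ C) →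
    H ≗ 𝟙 ⊕ (x ⊛ (G ⊕ (C ⊛ (H ⊝ 𝟙)))) →
    F ⊛ denomAt x (𝟙 ⊝ (constPS (+ 2) ⊛ (x ⊛ C))) ≗ constPS (+ 2) ⊛ (x ⊛ x)
  functionalEquations⇒F⊛denom F C G H x eq₁ eq₂ eq₃ eq₄ =
    ⊝≗𝟘⇒≗ (λ n → trans (certificate n) (combination≗𝟘 n))
    where
    𝟚 𝟜 E₁ E₂ E₃ E₄ A B D β combination : PS
    𝟚  = constPS (+ 2)
    𝟜  = constPS (+ 4)
    E₁ = C ⊝ (𝟙 ⊕ (x ⊛ (C ⊛ C)))
    E₂ = F ⊝ (x ⊛ (((F ⊛ C) ⊕ (C ⊛ F)) ⊕ G))
    E₃ = G ⊝ (x ⊛ (H ⊛ C))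
    E₄ = H ⊝ (𝟙 ⊕ (x ⊛ (G ⊕ (C ⊛ (H ⊝ 𝟙)))))
    A  = 𝟙 ⊝ (x ⊛ C)
    B  = 𝟙 ⊝ (((x ⊛ x) ⊛ C) ⊛ C)
    D  = ((C ⊛ E₄) ⊕ ((x ⊛ C) ⊛ E₃)) ⊕ ((𝟙 ⊝ H) ⊛ E₁)
    β  = (((𝟜 ⊛ x) ⊕ ((𝟜 ⊛ x) ⊛ x)) ⊕ (((𝟚 ⊛ x) ⊛ x) ⊛ C)) ⊝ (((((𝟜 ⊛ x) ⊛ x) ⊛ x) ⊛ C) ⊛ C)
    combination =
      ((((F ⊛ β) ⊛ E₁) ⊕ (((𝟚 ⊛ A) ⊛ B) ⊛ E₂)) ⊕ ((((𝟚 ⊛ x) ⊛ A) ⊛ B) ⊛ E₃)) ⊕ (((𝟚 ⊛ x) ⊛ x) ⊛ (((E₁ ⊛ D) ⊕ E₁) ⊕ D))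

    -- Cofactors exhibiting F·Den − 2x² in the ideal generated by E₁, …, E₄.
    certificate : (F ⊛ denomAt x (𝟙 ⊝ (𝟚 ⊛ (x ⊛ C)))) ⊝ (𝟚 ⊛ (x ⊛ x)) ≗ combination
    certificate = solve 5 (λ F C G H x →
      let 𝟙′ = con (+ 1)
          𝟚  = con (+ 2)
          𝟜  = con (+ 4)
          E₁ = C :- (𝟙′ :+ (x :* (C :* C)))
          E₂ = F :- (x :* (((F :* C) :+ (C :* F)) :+ G))
          E₃ = G :- (x :* (H :* C))
          E₄ = H :- (𝟙′ :+ (x :* (G :+ (C :* (H :- 𝟙′)))))
          A  = 𝟙′ :- (x :* C)
          B  = 𝟙′ :- (((x :* x) :* C) :* C)
          D  = ((C :* E₄) :+ ((x :* C) :* E₃)) :+ ((𝟙′ :- H) :* E₁)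
          β  = (((𝟜 :* x) :+ ((𝟜 :* x) :* x)) :+ (((𝟚 :* x) :* x) :* C)) :- (((((𝟜 :* x) :* x) :* x) :* C) :* C)
          T  = 𝟙′ :- (𝟚 :* (x :* C))
          Den = ((𝟙′ :+ (con (- + 3) :* x)) :+ (con (- + 4) :* (x :* x))) :+ ((𝟙′ :- x) :* T)
      in
      (F :* Den) :- (𝟚 :* (x :* x)) :=
      ((((F :* β) :* E₁) :+ (((𝟚 :* A) :* B) :* E₂)) :+ ((((𝟚 :* x) :* A) :* B) :* E₃))
        :+ (((𝟚 :* x) :* x) :* (((E₁ :* D) :+ E₁) :+ D)))
      (λ _ → refl) F C G H x

    E₁≗𝟘 : E₁ ≗ 𝟘
    E₁≗𝟘 = ≗⇒⊝≗𝟘 eq₁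
    E₃≗𝟘 : E₃ ≗ 𝟘
    E₃≗𝟘 = ≗⇒⊝≗𝟘 eq₃
    D≗𝟘 : D ≗ 𝟘
    D≗𝟘 = ≗𝟘-⊕ (≗𝟘-⊕ (≗𝟘-⊛ C (≗⇒⊝≗𝟘 eq₄)) (≗𝟘-⊛ (x ⊛ C) E₃≗𝟘)) (≗𝟘-⊛ (𝟙 ⊝ H) E₁≗𝟘)
    combination≗𝟘 : combination ≗ 𝟘
    combination≗𝟘 =
      ≗𝟘-⊕ (≗𝟘-⊕ (≗𝟘-⊕ (≗𝟘-⊛ (F ⊛ β) E₁≗𝟘) (≗𝟘-⊛ ((𝟚 ⊛ A) ⊛ B) (≗⇒⊝≗𝟘 eq₂))) (≗𝟘-⊛ (((𝟚 ⊛ x) ⊛ A) ⊛ B) E₃≗𝟘))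
           (≗𝟘-⊛ ((𝟚 ⊛ x) ⊛ x) (≗𝟘-⊕ (≗𝟘-⊕ (≗𝟘-⊛ E₁ D≗𝟘) E₁≗𝟘) D≗𝟘))

  √1-4z : PS
  √1-4z = 𝟙 ⊝ (constPS (+ 2) ⊛ (z ⊛ C))

  √1-4z-unique : ∀ S → S 0 ≡ + 1 → (∀ n → (S ⊛ S) n ≡ oneMinus4z n) → S ≗ √1-4z
  √1-4z-unique S S₀≡1 S²≡1-4z = ⊝≗𝟘⇒≗ (⊛-cancelʳ (S ⊝ √1-4z) (S ⊕ √1-4z) constantTerm≢0 product≗𝟘)
    where
    product≗𝟘 : (S ⊝ √1-4z) ⊛ (S ⊕ √1-4z) ≗ 𝟘
    product≗𝟘 n = trans (differenceOfSquares C S z n)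
      (≗𝟘-⊕ (≗⇒⊝≗𝟘 (λ n → trans (S²≡1-4z n) (oneMinus4z≗ n))) (≗𝟘-⊛ (constPS (+ 4) ⊛ z) (≗⇒⊝≗𝟘 C-equation)) n)
    constantTerm≢0 : (S ⊕ √1-4z) 0 ≢ 0ℤ
    constantTerm≢0 rewrite S₀≡1 | constPS-⊛ (+ 2) (z ⊛ C) 0 | z⊛-zero C = λ ()

  F⊛denom≗2z² : F ⊛ denomAt z √1-4z ≗ constPS (+ 2) ⊛ (z ⊛ z)
  F⊛denom≗2z² = functionalEquations⇒F⊛denom F C G H z C-equation F-equation G-equation H-equation

open PowerSeries using (⊛-cong; z; constPS)
open GeneratingFunctions
open import Data.Integer using (+_)
open import Relation.Binary.PropositionalEquality using (_≡_; module ≡-Reasoning)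

corollary3p2 : (S : PS) → S 0 ≡ + 1 → (∀ n → (S ⊛ S) n ≡ oneMinus4z n) →
    ∀ n → (svalGF ⊛ denom S) n ≡ numer n
corollary3p2 S S₀≡1 S²≡1-4z n = begin
  (svalGF ⊛ denom S) n              ≡⟨ ⊛-cong svalGF≗F (denom≗denomAt (√1-4z-unique S S₀≡1 S²≡1-4z)) n ⟩
  (F ⊛ denomAt z √1-4z) n           ≡⟨ F⊛denom≗2z² n ⟩
  (constPS (+ 2) ⊛ (z ⊛ z)) n       ≡⟨ numer≗2z² n ⟨
  numer n                           ∎
  where open ≡-Reasoning
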